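{- Let $P$ be a finite poset with an element $s$ such that (1) for all $x\in P$, either $s\vee x$ or $s\wedge x$ exists in $P$; and (2) for all $x,y\in P$ such that $x<y$, if $s\wedge x$ does not exist but $s\wedge y$ does exist, then $(s\wedge y)\vee x$ exists in $P$. Then the order complex $\Delta(P)$ is non-evasive.
   Context: A simplicial complex is a down-set $\Sigma$ of a power set of a set (the empty set $\emptyset$ is allowed to be a member). Its vertex set is $V(\Sigma)=\{x\mid \{x\}\in\Sigma\}$. For $W\subseteq V$, $\Sigma|W=\{\sigma\in\Sigma\mid \sigma\subseteq W\}$. For $\sigma\in\Sigma$: $\mathrm{dl}_\Sigma(\sigma)=\Sigma|(V\setminus\sigma)$, $\mathrm{st}_\Sigma(\sigma)=\{\tau\in\Sigma\mid \sigma\cup\tau\in\Sigma\}$, $\mathrm{lk}_\Sigma(\sigma)=\mathrm{dl}_\Sigma(\sigma)\cap\mathrm{st}_\Sigma(\sigma)$; for a vertex $v$ write $\mathrm{dl}_\Sigma(v)$, $\mathrm{lk}_\Sigma(v)$ for $\sigma=\{v\}$. Non-evasiveness is defined by induction on $|V|$ (for $V$ finite): $\Sigma$ is non-evasive if for some $v\in V$, either $\Sigma=\{\emptyset,\{v\}\}$, or $|V|>1$ and both $\mathrm{dl}_\Sigma(v)$ and $\mathrm{lk}_\Sigma(v)$ are non-evasive. (In particular $\{\emptyset\}$ is not non-evasive.) The order complex $\Delta(P)$ of a poset $P$ is the simplicial complex of all chains (totally ordered subsets, including $\emptyset$) of $P$. -}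

module Defs where

open import Data.Nat using (ℕ)
open import Data.Fin using (Fin)
open import Data.Fin.Subset using (Subset; _∈_; _∉_; ⁅_⁆; _∪_) renaming (⊥ to ∅)
open import Data.Product using (Σ; ∃; _×_; _,_)
open import Data.Sum using (_⊎_)
open import Relation.Nullary using (¬_)
open import Relation.Binary.PropositionalEquality using (_≡_; _≢_)
open import Function.Bundles using (_⇔_)
open import Level using (suc; zero)

-- Simplicial complexes on the vertex universe Fin n.
-- A complex is a family of faces (subsets of Fin n); complexes arising
-- here (order complexes and their deletions/links) are down-sets.

Complex : ℕ → Set₁
Complex n = Subset n → Set

module _ {n : ℕ} where

  IsVertex : Complex n → Fin n → Set
  IsVertex K x = K ⁅ x ⁆

  dl : Complex n → Fin n → Complex n
  dl K v σ = K σ × v ∉ σ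

  st : Complex n → Fin n → Complex n
  st K v τ = K τ × K (τ ∪ ⁅ v ⁆)

  lk : Complex n → Fin n → Complex n
  lk K v σ = dl K v σ × st K v σ

  IsPoint : Complex n → Fin n → Set
  IsPoint K v = ∀ σ → K σ ⇔ (σ ≡ ∅ ⊎ σ ≡ ⁅ v ⁆)

  -- Non-evasiveness, defined inductively (the recursion is on the
  -- number of vertices, which strictly decreases in dl and lk).
  data NonEvasive (K : Complex n) : Set₁ where
    point : (v : Fin n) → IsPoint K v → NonEvasive K
    split : (v : Fin n) → IsVertex K v →
            (∃ λ w → w ≢ v × IsVertex K w) →
            NonEvasive (dl K v) → NonEvasive (lk K v) → NonEvasive K

module _ {n : ℕ} (_≤_ : Fin n → Fin n → Set) where

  OrderComplex : Complex n
  OrderComplex σ = ∀ i j → i ∈ σ → j ∈ σ → (i ≤ j ⊎ j ≤ i)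

  IsJoin : Fin n → Fin n → Fin n → Set
  IsJoin a b z = a ≤ z × b ≤ z × (∀ w → a ≤ w → b ≤ w → z ≤ w)

  IsMeet : Fin n → Fin n → Fin n → Set
  IsMeet a b z = z ≤ a × z ≤ b × (∀ w → w ≤ a → w ≤ b → w ≤ z)

  JoinExists : Fin n → Fin n → Set
  JoinExists a b = ∃ λ z → IsJoin a b z

  MeetExists : Fin n → Fin n → Set
  MeetExists a b = ∃ λ z → IsMeet a b z

  _<_ : Fin n → Fin n → Set
  x < y = x ≤ y × x ≢ y

-- Write Δ(S) for the order complex of a subposet S. Deleting a vertex v of Δ(S) gives Δ(S - v), and
-- its link is Δ(S<v ∪ S>v), the join of Δ(S<v) and Δ(S>v); hence Δ(S) is non-evasive when S has an
-- element comparable to all others, the link of v is non-evasive as soon as Δ(S<v) or Δ(S>v) is, and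
-- Δ(S) stays non-evasive when a vertex with non-evasive link is added. Starting from ↓s, add the
-- elements x for which s ∧ x exists in increasing order: the part below x has greatest element s ∧ x.
-- Then add the remaining x in decreasing order; the part above x is {y > x | s ∧ y exists}, and by (1)
-- the join s ∨ x exists. Growing that set from the fixed points of y ↦ (s ∧ y) ∨ x, whose greatest
-- element is s ∨ x, condition (2) makes (s ∧ y) ∨ x the greatest element below each new y.
module Submission where

open import Defs hiding (_<_)
open import Data.Empty using (⊥-elim)
open import Data.Fin using (Fin; _≟_)
open import Data.Fin.Properties using (any?; all?)
open import Data.Fin.Subset using (Subset; _⊂_; ⁅_⁆)
  renaming (_∈_ to _∈ₛ_; _∉_ to _∉ₛ_; _∪_ to _∪ₛ_; ⊥ to ∅)
open import Data.Fin.Subset.Induction using (⊂-wellFounded)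
open import Data.Fin.Subset.Properties using (_∈?_; ∉⊥; x∈⁅x⁆; x∈⁅y⁆⇒x≡y; x∈p∪q⁻; x∈p∪q⁺; ⊆-antisym)
open import Data.Nat using (ℕ)
open import Data.Product using (_×_; ∃; _,_; proj₁; proj₂)
open import Data.Sum using (_⊎_; inj₁; inj₂; [_,_]; swap)
open import Data.Unit using (⊤; tt)
open import Data.Vec using (tabulate)
open import Data.Vec.Properties using (lookup∘tabulate; lookup⇒[]=; []=⇒lookup)
open import Function.Base using (_∘_; flip)
open import Function.Bundles using (mk⇔; Equivalence)
open import Induction.WellFounded using (WellFounded; Acc; acc)
open import Relation.Binary.Definitions using (Decidable)
open import Relation.Binary.PropositionalEquality using (_≡_; _≢_; refl; sym; trans; subst)
open import Relation.Binary.Structures using (IsDecPartialOrder; IsStrictPartialOrder)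
open import Relation.Nullary using (¬_; Dec; yes; no; does)
open import Relation.Nullary.Decidable using (_×-dec_; _⊎-dec_; _→-dec_; ¬?; dec-true; decidable-stable)
import Relation.Binary.Construct.Flip.EqAndOrd as Flip
import Relation.Binary.Construct.NonStrictToStrict as NonStrictToStrict
import Relation.Binary.Construct.On as On

record DecSubset (n : ℕ) : Set₁ where
  constructor ⟨_,_⟩
  field
    _∋_  : Fin n → Set
    _∋?_ : ∀ x → Dec (_∋_ x)
open DecSubset

module _ {n : ℕ} where

  infixr 7 _∩_
  infixr 6 _∪_
  infixl 8 _-_
  infix 4 _⊆_ _≐_ _⊏_

  _∩_ _∪_ : DecSubset n → DecSubset n → DecSubset n
  A ∩ B = ⟨ (λ x → A ∋ x × B ∋ x) , (λ x → A ∋? x ×-dec B ∋? x) ⟩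
  A ∪ B = ⟨ (λ x → A ∋ x ⊎ B ∋ x) , (λ x → A ∋? x ⊎-dec B ∋? x) ⟩

  ∁ : DecSubset n → DecSubset n
  ∁ A = ⟨ (λ x → ¬ A ∋ x) , (λ x → ¬? (A ∋? x)) ⟩

  _-_ : DecSubset n → Fin n → DecSubset n
  S - v = ⟨ (λ x → S ∋ x × x ≢ v) , (λ x → S ∋? x ×-dec ¬? (x ≟ v)) ⟩

  _⊆_ : DecSubset n → DecSubset n → Set
  A ⊆ B = ∀ {x} → A ∋ x → B ∋ x

  -- A record rather than a product, so that A and B can be inferred from A ≐ B.
  record _≐_ (A B : DecSubset n) : Set where
    constructor _,_
    field
      to : A ⊆ B
      from : B ⊆ A

  ≐-sym : ∀ {A B} → A ≐ B → B ≐ A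
  ≐-sym (A⊆B , B⊆A) = B⊆A , A⊆B

  ≐-trans : ∀ {A B C} → A ≐ B → B ≐ C → A ≐ C
  ≐-trans (A⊆B , B⊆A) (B⊆C , C⊆B) = B⊆C ∘ A⊆B , B⊆A ∘ C⊆B

  ∪-comm : ∀ {A B} → A ∪ B ≐ B ∪ A
  ∪-comm = swap , swap

  ⊆-stable : ∀ {A B} → A ⊆ B → (∀ {x} → B ∋ x → ¬ ¬ A ∋ x) → A ≐ B
  ⊆-stable {A} A⊆B ¬¬A = A⊆B , λ {x} Bx → decidable-stable (A ∋? x) (¬¬A Bx)

  -- The characteristic vector of a decidable subset, used only as a termination measure.
  ⌊_⌋ : DecSubset n → Subset n
  ⌊ S ⌋ = tabulate (λ x → does (S ∋? x))

  ∋⇒∈⌊⌋ : ∀ S {x} → S ∋ x → x ∈ₛ ⌊ S ⌋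
  ∋⇒∈⌊⌋ S {x} Sx = lookup⇒[]= x ⌊ S ⌋ (trans (lookup∘tabulate _ x) (dec-true (S ∋? x) Sx))

  ∈⌊⌋⇒∋ : ∀ S {x} → x ∈ₛ ⌊ S ⌋ → S ∋ x
  ∈⌊⌋⇒∋ S {x} x∈S with S ∋? x | trans (sym (lookup∘tabulate _ x)) ([]=⇒lookup x∈S)
  ... | yes Sx | _ = Sx
  ... | no _   | ()

  _⊏_ : DecSubset n → DecSubset n → Set
  A ⊏ B = ⌊ A ⌋ ⊂ ⌊ B ⌋

  ⊏-wellFounded : WellFounded _⊏_
  ⊏-wellFounded = On.wellFounded ⌊_⌋ ⊂-wellFounded

  ⊆-∌⇒⊏ : ∀ A B {x} → A ⊆ B → B ∋ x → ¬ A ∋ x → A ⊏ B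
  ⊆-∌⇒⊏ A B A⊆B Bx ¬Ax =
    (λ x∈A → ∋⇒∈⌊⌋ B (A⊆B (∈⌊⌋⇒∋ A x∈A))) , _ , ∋⇒∈⌊⌋ B Bx , λ x∈A → ¬Ax (∈⌊⌋⇒∋ A x∈A)

  -⊏ : ∀ S {v} → S ∋ v → S - v ⊏ S
  -⊏ S {v} Sv = ⊆-∌⇒⊏ (S - v) S proj₁ Sv (λ (_ , v≢v) → v≢v refl)

  module _ {R : Fin n → Fin n → Set} (R-spo : IsStrictPartialOrder _≡_ R) (R? : Decidable R) where
    open IsStrictPartialOrder R-spo renaming (irrefl to R-irrefl; trans to R-trans)

    R-minimal : ∀ S → Acc _⊏_ S → ∀ {x} → S ∋ x → ∃ λ m → S ∋ m × (∀ {y} → S ∋ y → ¬ R y m)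
    R-minimal S (acc rec) {x} Sx with any? (λ y → S ∋? y ×-dec R? y x)
    ... | no ∄ = x , Sx , λ Sy Ryx → ∄ (_ , Sy , Ryx)
    ... | yes (y , Sy , Ryx) with R-minimal (S ∩ R-below) (rec S∩R-below⊏S) (Sy , Ryx)
      where
      R-below : DecSubset n
      R-below = ⟨ (λ z → R z x) , (λ z → R? z x) ⟩
      S∩R-below⊏S : S ∩ R-below ⊏ S
      S∩R-below⊏S = ⊆-∌⇒⊏ (S ∩ R-below) S proj₁ Sx (λ (_ , Rxx) → R-irrefl refl Rxx)
    ... | m , (Sm , Rmx) , min = m , Sm , λ Sz Rzm → min (Sz , R-trans Rzm Rmx) Rzm

NonEvasive-resp : ∀ {n} {K L : Complex n} → (∀ {σ} → K σ → L σ) → (∀ {σ} → L σ → K σ) →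
                  NonEvasive K → NonEvasive L
NonEvasive-resp K⊆L L⊆K (point v Kpt) =
  point v (λ σ → mk⇔ (Equivalence.to (Kpt σ) ∘ L⊆K) (K⊆L ∘ Equivalence.from (Kpt σ)))
NonEvasive-resp K⊆L L⊆K (split v Kv (w , w≢v , Kw) del lnk) = split v (K⊆L Kv) (w , w≢v , K⊆L Kw)
  (NonEvasive-resp (λ (Kσ , v∉σ) → K⊆L Kσ , v∉σ) (λ (Lσ , v∉σ) → L⊆K Lσ , v∉σ) del)
  (NonEvasive-resp (λ ((Kσ , v∉σ) , (Kσ′ , Kσv)) → (K⊆L Kσ , v∉σ) , (K⊆L Kσ′ , K⊆L Kσv))
                   (λ ((Lσ , v∉σ) , (Lσ′ , Lσv)) → (L⊆K Lσ , v∉σ) , (L⊆K Lσ′ , L⊆K Lσv)) lnk)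

module Poset {n : ℕ} {_≤_ : Fin n → Fin n → Set} (≤-isDecPartialOrder : IsDecPartialOrder _≡_ _≤_) where
  open IsDecPartialOrder ≤-isDecPartialOrder
    using (isPartialOrder; reflexive; _≤?_) renaming (refl to ≤-refl; trans to ≤-trans)
  open NonStrictToStrict _≡_ _≤_ using (_<_; <-isStrictPartialOrder; <-decidable; <-trans)

  <-spo : IsStrictPartialOrder _≡_ _<_
  <-spo = <-isStrictPartialOrder isPartialOrder

  _<?_ : Decidable _<_
  _<?_ = <-decidable _≟_ _≤?_

  Comparable : Fin n → Fin n → Set
  Comparable x y = x ≤ y ⊎ y ≤ x

  comparableWith below above : Fin n → DecSubset n
  comparableWith v = ⟨ Comparable v , (λ x → (v ≤? x) ⊎-dec (x ≤? v)) ⟩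
  below x = ⟨ (_< x) , (_<? x) ⟩
  above x = ⟨ (x <_) , (x <?_) ⟩

  link : DecSubset n → Fin n → DecSubset n
  link S v = (S ∩ comparableWith v) - v

  link⊏ : ∀ S {v} → S ∋ v → link S v ⊏ S
  link⊏ S {v} Sv = ⊆-∌⇒⊏ (link S v) S (λ ((Sx , _) , _) → Sx) Sv (λ (_ , v≢v) → v≢v refl)

  -- Non-evasiveness of the order complex of the induced subposet S, phrased on S itself:
  -- the deletion and the link of v in Δ(S) are Δ(S - v) and Δ(link S v).
  data NonEvasiveOn (S : DecSubset n) : Set₁ where
    point : ∀ v → S ∋ v → (∀ {w} → S ∋ w → w ≡ v) → NonEvasiveOn S
    split : ∀ v w → S ∋ v → S ∋ w → w ≢ v →
            NonEvasiveOn (S - v) → NonEvasiveOn (link S v) → NonEvasiveOn S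

  nonEvasiveOn⇒nonempty : ∀ {S} → NonEvasiveOn S → ∃ (S ∋_)
  nonEvasiveOn⇒nonempty (point v Sv _)         = v , Sv
  nonEvasiveOn⇒nonempty (split v _ Sv _ _ _ _) = v , Sv

  NonEvasiveOn-resp : ∀ {A B} → A ≐ B → NonEvasiveOn A → NonEvasiveOn B
  NonEvasiveOn-resp (A⊆B , B⊆A) (point v Av unique) = point v (A⊆B Av) (unique ∘ B⊆A)
  NonEvasiveOn-resp (A⊆B , B⊆A) (split v w Av Aw w≢v del lnk) = split v w (A⊆B Av) (A⊆B Aw) w≢v
    (NonEvasiveOn-resp ((λ (Ax , x≢v) → A⊆B Ax , x≢v) , (λ (Bx , x≢v) → B⊆A Bx , x≢v)) del)
    (NonEvasiveOn-resp ( (λ ((Ax , c) , x≢v) → (A⊆B Ax , c) , x≢v)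
                       , (λ ((Bx , c) , x≢v) → (B⊆A Bx , c) , x≢v)) lnk)

  cone : ∀ S {c} → S ∋ c → (∀ {x} → S ∋ x → Comparable c x) → NonEvasiveOn S
  cone S = cone′ S (⊏-wellFounded S)
    where
    cone′ : ∀ S → Acc _⊏_ S → ∀ {c} → S ∋ c → (∀ {x} → S ∋ x → Comparable c x) → NonEvasiveOn S
    cone′ S (acc rec) {c} Sc c~ with any? (λ w → S ∋? w ×-dec ¬? (w ≟ c))
    ... | no ∄ = point c Sc (λ {w} Sw → decidable-stable (w ≟ c) (λ w≢c → ∄ (w , Sw , w≢c)))
    ... | yes (w , Sw , w≢c) = split w c Sw Sc (w≢c ∘ sym)
      (cone′ (S - w) (rec (-⊏ S Sw)) (Sc , w≢c ∘ sym) (λ (Sx , _) → c~ Sx))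
      (cone′ (link S w) (rec (link⊏ S Sw)) ((Sc , swap (c~ Sw)) , w≢c ∘ sym) (λ ((Sx , _) , _) → c~ Sx))

  greatest⇒nonEvasiveOn : ∀ S {c} → S ∋ c → (∀ {x} → S ∋ x → x ≤ c) → NonEvasiveOn S
  greatest⇒nonEvasiveOn S Sc ≤c = cone S Sc (λ Sx → inj₂ (≤c Sx))

  Separated : DecSubset n → DecSubset n → Set
  Separated A B = ∀ {a b} → A ∋ a → B ∋ b → Comparable a b × a ≢ b

  Separated-sym : ∀ {A B} → Separated A B → Separated B A
  Separated-sym sep Bb Aa with sep Aa Bb
  ... | a~b , a≢b = swap a~b , a≢b ∘ sym

  -- Δ(A ∪ B) is the join Δ(A) * Δ(B), and a join with a non-evasive complex is non-evasive.
  join : ∀ {A} B → Separated A B → NonEvasiveOn A → NonEvasiveOn (A ∪ B)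
  join {A} B sep (point v Av unique) =
    cone (A ∪ B) (inj₁ Av) [ (λ Ax → inj₁ (reflexive (sym (unique Ax)))) , (λ Bx → proj₁ (sep Av Bx)) ]
  join {A} B sep (split v w Av Aw w≢v del lnk) = split v w (inj₁ Av) (inj₁ Aw) w≢v
    (NonEvasiveOn-resp deletion (join B (λ (Aa , _) → sep Aa) del))
    (NonEvasiveOn-resp linking (join B (λ ((Aa , _) , _) → sep Aa) lnk))
    where
    B∌v : ∀ {b} → B ∋ b → b ≢ v
    B∌v Bb = proj₂ (sep Av Bb) ∘ sym
    deletion : A - v ∪ B ≐ (A ∪ B) - v
    deletion = [ (λ (Ax , x≢v) → inj₁ Ax , x≢v) , (λ Bx → inj₂ Bx , B∌v Bx) ]
             , λ { (inj₁ Ax , x≢v) → inj₁ (Ax , x≢v) ; (inj₂ Bx , _) → inj₂ Bx }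
    linking : link A v ∪ B ≐ link (A ∪ B) v
    linking = [ (λ ((Ax , c) , x≢v) → (inj₁ Ax , c) , x≢v) , (λ Bx → (inj₂ Bx , proj₁ (sep Av Bx)) , B∌v Bx) ]
            , λ { ((inj₁ Ax , c) , x≢v) → inj₁ ((Ax , c) , x≢v) ; ((inj₂ Bx , _) , _) → inj₂ Bx }

  below-above-separated : ∀ U x → Separated (U ∩ below x) (U ∩ above x)
  below-above-separated U x (_ , a<x) (_ , x<b) with <-trans isPartialOrder a<x x<b
  ... | a≤b , a≢b = inj₁ a≤b , a≢b

  link≐below∪above : ∀ U x → link U x ≐ U ∩ below x ∪ U ∩ above x
  link≐below∪above U x =
      (λ { ((Uy , inj₁ x≤y) , y≢x) → inj₂ (Uy , x≤y , y≢x ∘ sym)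
         ; ((Uy , inj₂ y≤x) , y≢x) → inj₁ (Uy , y≤x , y≢x) })
    , [ (λ (Uy , y≤x , y≢x) → (Uy , inj₂ y≤x) , y≢x) , (λ (Uy , x≤y , x≢y) → (Uy , inj₁ x≤y) , x≢y ∘ sym) ]

  link-nonEvasiveOn : ∀ U x → NonEvasiveOn (U ∩ below x) ⊎ NonEvasiveOn (U ∩ above x) →
                      NonEvasiveOn (link U x)
  link-nonEvasiveOn U x (inj₁ ne) =
    NonEvasiveOn-resp (≐-sym (link≐below∪above U x)) (join (U ∩ above x) (below-above-separated U x) ne)
  link-nonEvasiveOn U x (inj₂ ne) =
    NonEvasiveOn-resp (≐-trans (∪-comm {A = U ∩ above x}) (≐-sym (link≐below∪above U x)))
      (join (U ∩ below x) (Separated-sym {A = U ∩ below x} {B = U ∩ above x} (below-above-separated U x)) ne)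

  -- The vertices of S outside T are added in R-increasing order, so only links of R-minimal ones matter.
  module _ {R : Fin n → Fin n → Set} (R-spo : IsStrictPartialOrder _≡_ R) (R? : Decidable R) where

    extend : ∀ {T S} → T ⊆ S → NonEvasiveOn T →
      (∀ U x → T ⊆ U → U ⊆ S → U ∋ x → ¬ T ∋ x → (∀ {y} → U ∋ y → R y x → T ∋ y) →
        NonEvasiveOn (link U x)) →
      NonEvasiveOn S
    extend {T} {S} T⊆S neT step with nonEvasiveOn⇒nonempty neT
    ... | t , Tt = go S (⊏-wellFounded S) T⊆S (λ Sx → Sx)
      where
      go : ∀ U → Acc _⊏_ U → T ⊆ U → U ⊆ S → NonEvasiveOn U
      go U (acc rec) T⊆U U⊆S with any? (λ x → U ∋? x ×-dec ¬? (T ∋? x))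
      ... | no ∄ = NonEvasiveOn-resp (⊆-stable {A = T} {B = U} T⊆U (λ Ux ¬Tx → ∄ (_ , Ux , ¬Tx))) neT
      ... | yes (x₀ , Ux₀ , ¬Tx₀) with R-minimal R-spo R? (U ∩ ∁ T) (⊏-wellFounded _) (Ux₀ , ¬Tx₀)
      ...   | x , (Ux , ¬Tx) , min = split x t Ux (T⊆U Tt) (T∌x Tt)
              (go (U - x) (rec (-⊏ U Ux)) (λ Ty → T⊆U Ty , T∌x Ty) (λ (Uy , _) → U⊆S Uy))
              (step U x T⊆U U⊆S Ux ¬Tx
                (λ {y} Uy Ryx → decidable-stable (T ∋? y) (λ ¬Ty → min (Uy , ¬Ty) Ryx)))
        where
        T∌x : ∀ {y} → T ∋ y → y ≢ x
        T∌x Ty refl = ¬Tx Ty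

  Δ : DecSubset n → Complex n
  Δ S σ = OrderComplex _≤_ σ × (∀ i → i ∈ₛ σ → S ∋ i)

  Δ-vertex : ∀ {S v} → S ∋ v → IsVertex (Δ S) v
  Δ-vertex {S} {v} Sv =
      (λ i j i∈ j∈ → inj₁ (reflexive (trans (x∈⁅y⁆⇒x≡y v i∈) (sym (x∈⁅y⁆⇒x≡y v j∈)))))
    , λ i i∈ → subst (S ∋_) (sym (x∈⁅y⁆⇒x≡y v i∈)) Sv

  Δ-point : ∀ {S v} → S ∋ v → (∀ {w} → S ∋ w → w ≡ v) → IsPoint (Δ S) v
  Δ-point {S} {v} Sv unique σ = mk⇔ to from
    where
    to : Δ S σ → σ ≡ ∅ ⊎ σ ≡ ⁅ v ⁆
    to (_ , σ⊆S) with v ∈? σ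
    ... | yes v∈σ = inj₂ (⊆-antisym (λ {x} x∈σ → subst (_∈ₛ ⁅ v ⁆) (sym (unique (σ⊆S x x∈σ))) (x∈⁅x⁆ v))
                                    (λ {x} x∈v → subst (_∈ₛ σ) (sym (x∈⁅y⁆⇒x≡y v x∈v)) v∈σ))
    ... | no v∉σ = inj₁ (⊆-antisym (λ {x} x∈σ → ⊥-elim (v∉σ (subst (_∈ₛ σ) (unique (σ⊆S x x∈σ)) x∈σ)))
                                   (⊥-elim ∘ ∉⊥))
    from : σ ≡ ∅ ⊎ σ ≡ ⁅ v ⁆ → Δ S σ
    from (inj₁ refl) = (λ _ _ i∈ _ → ⊥-elim (∉⊥ i∈)) , (λ _ i∈ → ⊥-elim (∉⊥ i∈))
    from (inj₂ refl) = Δ-vertex {S} Sv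

  chain-∪-⁅⁆ : ∀ {σ v} → OrderComplex _≤_ σ → (∀ i → i ∈ₛ σ → Comparable i v) →
               OrderComplex _≤_ (σ ∪ₛ ⁅ v ⁆)
  chain-∪-⁅⁆ {σ} {v} chain i~v i j i∈ j∈ with x∈p∪q⁻ σ ⁅ v ⁆ i∈ | x∈p∪q⁻ σ ⁅ v ⁆ j∈
  ... | inj₁ i∈σ | inj₁ j∈σ = chain i j i∈σ j∈σ
  ... | inj₁ i∈σ | inj₂ j∈v rewrite x∈⁅y⁆⇒x≡y v j∈v = i~v i i∈σ
  ... | inj₂ i∈v | inj₁ j∈σ rewrite x∈⁅y⁆⇒x≡y v i∈v = swap (i~v j j∈σ)
  ... | inj₂ i∈v | inj₂ j∈v = inj₁ (reflexive (trans (x∈⁅y⁆⇒x≡y v i∈v) (sym (x∈⁅y⁆⇒x≡y v j∈v))))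

  Δ-deletion⁺ : ∀ {S v σ} → Δ (S - v) σ → dl (Δ S) v σ
  Δ-deletion⁺ {v = v} (chain , σ⊆S-v) =
    (chain , λ i i∈σ → proj₁ (σ⊆S-v i i∈σ)) , λ v∈σ → proj₂ (σ⊆S-v v v∈σ) refl

  Δ-deletion⁻ : ∀ {S v σ} → dl (Δ S) v σ → Δ (S - v) σ
  Δ-deletion⁻ {σ = σ} ((chain , σ⊆S) , v∉σ) = chain , λ i i∈σ → σ⊆S i i∈σ , λ { refl → v∉σ i∈σ }

  Δ-link⁺ : ∀ {S v σ} → S ∋ v → Δ (link S v) σ → lk (Δ S) v σ
  Δ-link⁺ {S} {v} {σ} Sv (chain , σ⊆lk) =
    (Δσ , v∉σ) , Δσ , chain-∪-⁅⁆ chain (λ i i∈σ → swap (proj₂ (proj₁ (σ⊆lk i i∈σ)))) , σv⊆S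
    where
    Δσ : Δ S σ
    Δσ = chain , λ i i∈σ → proj₁ (proj₁ (σ⊆lk i i∈σ))
    v∉σ : v ∉ₛ σ
    v∉σ v∈σ = proj₂ (σ⊆lk v v∈σ) refl
    σv⊆S : ∀ i → i ∈ₛ σ ∪ₛ ⁅ v ⁆ → S ∋ i
    σv⊆S i i∈ = [ proj₂ Δσ i , (λ i∈v → subst (S ∋_) (sym (x∈⁅y⁆⇒x≡y v i∈v)) Sv) ] (x∈p∪q⁻ σ ⁅ v ⁆ i∈)

  Δ-link⁻ : ∀ {S v σ} → lk (Δ S) v σ → Δ (link S v) σ
  Δ-link⁻ {v = v} {σ} (((chain , σ⊆S) , v∉σ) , _ , chain′ , _) = chain , λ i i∈σ →
    (σ⊆S i i∈σ , swap (chain′ i v (x∈p∪q⁺ (inj₁ i∈σ)) (x∈p∪q⁺ (inj₂ (x∈⁅x⁆ v))))) , λ { refl → v∉σ i∈σ }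

  nonEvasiveOn⇒nonEvasive : ∀ {S} → NonEvasiveOn S → NonEvasive (Δ S)
  nonEvasiveOn⇒nonEvasive {S} (point v Sv unique) = point v (Δ-point {S} Sv unique)
  nonEvasiveOn⇒nonEvasive {S} (split v w Sv Sw w≢v del lnk) =
    split v (Δ-vertex {S} Sv) (w , w≢v , Δ-vertex {S} Sw)
    (NonEvasive-resp (Δ-deletion⁺ {S}) (Δ-deletion⁻ {S}) (nonEvasiveOn⇒nonEvasive del))
    (NonEvasive-resp (Δ-link⁺ {S} Sv) (Δ-link⁻ {S}) (nonEvasiveOn⇒nonEvasive lnk))

  isMeet? : ∀ a b z → Dec (IsMeet _≤_ a b z)
  isMeet? a b z = z ≤? a ×-dec z ≤? b ×-dec all? (λ w → w ≤? a →-dec w ≤? b →-dec w ≤? z)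

  isJoin? : ∀ a b z → Dec (IsJoin _≤_ a b z)
  isJoin? a b z = a ≤? z ×-dec b ≤? z ×-dec all? (λ w → a ≤? w →-dec b ≤? w →-dec z ≤? w)

  ≤⇒isMeet : ∀ {a b} → a ≤ b → IsMeet _≤_ a b a
  ≤⇒isMeet a≤b = ≤-refl , a≤b , λ _ w≤a _ → w≤a

  isMeet-sandwich : ∀ {a b c m} → IsMeet _≤_ a b m → m ≤ c → c ≤ b → IsMeet _≤_ a c m
  isMeet-sandwich (m≤a , _ , greatest) m≤c c≤b =
    m≤a , m≤c , λ w w≤a w≤c → greatest w w≤a (≤-trans w≤c c≤b)

  module _ (s : Fin n)
    (join-or-meet : ∀ x → JoinExists _≤_ s x ⊎ MeetExists _≤_ s x)
    (meet-join : ∀ x y → x < y → ¬ MeetExists _≤_ s x → MeetExists _≤_ s y →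
      ∀ m → IsMeet _≤_ s y m → JoinExists _≤_ m x)
    where

    ↓s Meetable P : DecSubset n
    ↓s = ⟨ (_≤ s) , (_≤? s) ⟩
    Meetable = ⟨ MeetExists _≤_ s , (λ x → any? (isMeet? s x)) ⟩
    P = ⟨ (λ _ → ⊤) , (λ _ → yes tt) ⟩

    ↓s-nonEvasiveOn : NonEvasiveOn ↓s
    ↓s-nonEvasiveOn = greatest⇒nonEvasiveOn ↓s ≤-refl (λ x≤s → x≤s)

    Meetable-nonEvasiveOn : NonEvasiveOn Meetable
    Meetable-nonEvasiveOn = extend <-spo _<?_ ↓s⊆Meetable ↓s-nonEvasiveOn added-link-nonEvasiveOn
      where
      ↓s⊆Meetable : ↓s ⊆ Meetable
      ↓s⊆Meetable x≤s = _ , x≤s , ≤-refl , λ _ _ w≤x → w≤x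
      -- Every element of U below x lies in ↓s, so s ∧ x is the greatest of them.
      added-link-nonEvasiveOn : ∀ U x → ↓s ⊆ U → U ⊆ Meetable → U ∋ x → ¬ x ≤ s →
                                (∀ {y} → U ∋ y → y < x → y ≤ s) → NonEvasiveOn (link U x)
      added-link-nonEvasiveOn U x ↓s⊆U U⊆M Ux x≰s below⇒≤s with U⊆M Ux
      ... | m , m≤s , m≤x , greatest = link-nonEvasiveOn U x (inj₁
            (greatest⇒nonEvasiveOn (U ∩ below x) (↓s⊆U m≤s , m≤x , m≢x)
              (λ (Uy , y<x) → greatest _ (below⇒≤s Uy y<x) (proj₁ y<x))))
        where
        m≢x : m ≢ x
        m≢x refl = x≰s m≤s

    above-nonMeetable-nonEvasiveOn : ∀ {x} → ¬ MeetExists _≤_ s x → NonEvasiveOn (Meetable ∩ above x)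
    above-nonMeetable-nonEvasiveOn {x} ¬meet =
      extend <-spo _<?_ Closed⊆Meetable∩above Closed-nonEvasiveOn added-link-nonEvasiveOn
      where
      -- the fixed points of the closure y ↦ (s ∧ y) ∨ x
      Closed : DecSubset n
      Closed = ⟨ (λ y → ∃ λ m → IsMeet _≤_ s y m × IsJoin _≤_ m x y)
               , (λ y → any? (λ m → isMeet? s y m ×-dec isJoin? m x y)) ⟩

      Closed⊆Meetable∩above : Closed ⊆ Meetable ∩ above x
      Closed⊆Meetable∩above (m , meet , _ , x≤y , _) = (m , meet) , x≤y , λ { refl → ¬meet (m , meet) }

      Closed-nonEvasiveOn : NonEvasiveOn Closed
      Closed-nonEvasiveOn with join-or-meet x
      ... | inj₂ meet = ⊥-elim (¬meet meet)
      ... | inj₁ (j , s≤j , x≤j , least) =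
            greatest⇒nonEvasiveOn Closed (s , ≤⇒isMeet s≤j , s≤j , x≤j , least)
              (λ (m , (m≤s , _) , _ , _ , least′) → least′ j (≤-trans m≤s s≤j) x≤j)

      -- Every element of U below y is closed, so (s ∧ y) ∨ x is the greatest of them.
      added-link-nonEvasiveOn : ∀ U y → Closed ⊆ U → U ⊆ Meetable ∩ above x → U ∋ y → ¬ Closed ∋ y →
                                (∀ {z} → U ∋ z → z < y → Closed ∋ z) → NonEvasiveOn (link U y)
      added-link-nonEvasiveOn U y Closed⊆U U⊆ Uy ¬Closed-y below⇒Closed
        with U⊆ Uy
      ... | (m , meet) , x<y with meet-join x y x<y ¬meet (m , meet) m meet
      ...   | k , m≤k , x≤k , least = link-nonEvasiveOn U y (inj₁
              (greatest⇒nonEvasiveOn (U ∩ below y) (Closed⊆U Closed-k , k≤y , k≢y) ≤k))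
        where
        k≤y : k ≤ y
        k≤y = least y (proj₁ (proj₂ meet)) (proj₁ x<y)
        Closed-k : Closed ∋ k
        Closed-k = m , isMeet-sandwich meet m≤k k≤y , m≤k , x≤k , least
        k≢y : k ≢ y
        k≢y refl = ¬Closed-y Closed-k
        ≤k : ∀ {z} → (U ∩ below y) ∋ z → z ≤ k
        ≤k (Uz , z<y) with below⇒Closed Uz z<y
        ... | m′ , (m′≤s , m′≤z , _) , _ , _ , least′ =
              least′ k (≤-trans (proj₂ (proj₂ meet) m′ m′≤s (≤-trans m′≤z (proj₁ z<y))) m≤k) x≤k

    P-nonEvasiveOn : NonEvasiveOn P
    P-nonEvasiveOn = extend (Flip.isStrictPartialOrder <-spo) (flip _<?_) (λ _ → tt)
                            Meetable-nonEvasiveOn added-link-nonEvasiveOn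
      where
      -- Every element of U above x is meetable, so the part of U above x is that of Meetable.
      added-link-nonEvasiveOn : ∀ U x → Meetable ⊆ U → U ⊆ P → U ∋ x → ¬ Meetable ∋ x →
                                (∀ {y} → U ∋ y → x < y → Meetable ∋ y) → NonEvasiveOn (link U x)
      added-link-nonEvasiveOn U x Meetable⊆U _ _ ¬meet above⇒Meetable = link-nonEvasiveOn U x (inj₂
        (NonEvasiveOn-resp ( (λ (My , x<y) → Meetable⊆U My , x<y)
                           , (λ (Uy , x<y) → above⇒Meetable Uy x<y , x<y))
                           (above-nonMeetable-nonEvasiveOn ¬meet)))

-- Definitionally the strict order of NonStrictToStrict used in Poset.
open Defs using (_<_)

corollary15 : (n : ℕ) (_≤_ : Fin n → Fin n → Set) →
    IsDecPartialOrder _≡_ _≤_ →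
    (s : Fin n) →
    (∀ x → JoinExists _≤_ s x ⊎ MeetExists _≤_ s x) →
    (∀ x y → _<_ _≤_ x y → ¬ MeetExists _≤_ s x → MeetExists _≤_ s y →
    ∀ m → IsMeet _≤_ s y m → JoinExists _≤_ m x) →
    NonEvasive (OrderComplex _≤_)
corollary15 n _≤_ ≤-isDecPartialOrder s join-or-meet meet-join =
  NonEvasive-resp proj₁ (λ chain → chain , λ _ _ → tt)
    (nonEvasiveOn⇒nonEvasive (P-nonEvasiveOn s join-or-meet meet-join))
  where open Poset ≤-isDecPartialOrder
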